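{- Let $N, s, t$ be positive integers and let $C:[1,N]\to\{0,1\}$ be a coloring such that there is no monochromatic triple $\{x,\,x+sy,\,x+(s+t)y\}\subseteq[1,N]$ with $x$ a positive integer and $y\in\{1,2,3\}$. For $b\in[1,N-3s]$ define $V(b)=(C(b),C(b+s),C(b+2s),C(b+3s))$. Let $a\in[1,N-3s]$ and $u\in\{0,1\}$. 1) If $V(a)=(u,1-u,1-u,u)$ and $V(a+t)=(1-u,1-u,u,u)$, then $V(a+jt)=(u,1-u,1-u,u)$ if $j\equiv0\pmod4$, $V(a+jt)=(1-u,1-u,u,u)$ if $j\equiv1\pmod4$, $V(a+jt)=(1-u,u,u,1-u)$ if $j\equiv2\pmod4$, and $V(a+jt)=(u,u,1-u,1-u)$ if $j\equiv3\pmod4$, for all integers $j$ with $0\le j\le 2\left\lfloor\frac{N-a-3s-2t}{2t}\right\rfloor$. 2) If $V(a)=(u,1-u,1-u,u)$ and $V(a+t)=(1-u,u,u,1-u)$, then $V(a+jt)=(u,1-u,1-u,u)$ if $j$ is even and $V(a+jt)=(1-u,u,u,1-u)$ if $j$ is odd, for all integers $j$ with $0\le j\le\left\lfloor\frac{N-a-3s-2t}{t}\right\rfloor$.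
   Context: $[1,N]=\{1,2,\dots,N\}$. A set is monochromatic under $C$ if $C$ is constant on it. If $u\in\{0,1\}$ is one color, $1-u$ denotes the other color. -}

module Defs where

open import Data.Nat using (ℕ; zero; suc; _+_; _*_; _≤_)
open import Data.Bool using (Bool; not)
open import Data.Product using (_×_; _,_)

-- A colouring of [1,N] by {0,1}; encoded as a function ℕ → Bool,
-- only its values on [1,N] are ever used.
Coloring : Set
Coloring = ℕ → Bool

InRange : ℕ → ℕ → Set
InRange N m = 1 ≤ m × m ≤ N

-- No monochromatic triple {x, x+sy, x+(s+t)y} ⊆ [1,N], x ≥ 1, y ∈ {1,2,3}.
-- (Since s,t,y ≥ 1 the three elements are distinct, x < x+sy < x+(s+t)y,
-- so the triple lies in [1,N] iff 1 ≤ x and x+(s+t)y ≤ N.)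
NoMonoTriple : ℕ → ℕ → ℕ → Coloring → Set
NoMonoTriple N s t C =
  ∀ (x y : ℕ) → 1 ≤ x → 1 ≤ y → y ≤ 3 →
  InRange N x → InRange N (x + s * y) → InRange N (x + (s + t) * y) →
  (C x ≡ C (x + s * y) × C x ≡ C (x + (s + t) * y)) → ⊥
  where
  open import Relation.Binary.PropositionalEquality using (_≡_)
  open import Data.Empty using (⊥)

V : ℕ → Coloring → ℕ → Bool × Bool × Bool × Bool
V s C b = C b , C (b + s) , C (b + 2 * s) , C (b + 3 * s)

P0 P1 P2 P3 : Bool → Bool × Bool × Bool × Bool
P0 u = u , not u , not u , u
P1 u = not u , not u , u , u
P2 u = not u , u , u , not u
P3 u = u , u , not u , not u

open import Data.Nat using (_<_; _/_; >-nonZero)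
floorDiv : ℕ → (d : ℕ) → 0 < d → ℕ
floorDiv n d p = _/_ n d {{>-nonZero p}}

module Submission where

-- Place the point b + i t + k s (0 ≤ k ≤ 3) at row i, column k of a grid, so that row i reads
-- V(b + i t). A forbidden triple {x, x + s y, x + (s + t) y} is then a triangle with corners
-- (i, k), (i, k + y), (i + y, k + y), and a colouring without monochromatic triples colours no
-- such triangle monochromatically. Forcing colours around these triangles shows that rows
-- P0 u, P2 u are followed by P0 u, and rows P0 u, P1 u by P2 u and then P3 u. As P2 u = P0 (1 - u)
-- and P3 u = P1 (1 - u), the same step applies again one row (resp. two rows) further down, for as
-- long as the grid stays inside [1, N].

open import Defs
open import Data.Nat using (ℕ; zero; suc; _+_; _*_; _∸_; _≤_; _<_; _%_; _≤?_; s≤s; >-nonZero)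
open import Data.Nat.Properties
open import Data.Nat.DivMod using (m/n*n≤m)
open import Data.Nat.Tactic.RingSolver using (solve-∀)
open import Data.Bool using (Bool; true; false; not)
open import Data.Bool.Properties using (¬-not; not-injective; not-involutive)
open import Data.Product using (_×_; _,_)
open import Relation.Nullary using (¬_)
open import Relation.Nullary.Decidable using (True; toWitness)
open import Relation.Binary.PropositionalEquality
  using (_≡_; refl; sym; trans; cong; subst; module ≡-Reasoning)

Pattern : Set
Pattern = Bool × Bool × Bool × Bool

Grid : Set
Grid = ℕ → ℕ → Bool

Row : Grid → ℕ → Pattern
Row G i = G i 0 , G i 1 , G i 2 , G i 3

Monochromatic : Bool → Bool → Bool → Set
Monochromatic a b d = a ≡ b × a ≡ d

TriangleFree : ℕ → Grid → Set
TriangleFree R G = ∀ i k y → 1 ≤ y → k + y ≤ 3 → i + y ≤ R →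
  ¬ Monochromatic (G i k) (G i (k + y)) (G (i + y) (k + y))

module _ {a b d : Bool} (free : ¬ Monochromatic a b d) {c : Bool} where

  last-forced : a ≡ c → b ≡ c → d ≡ not c
  last-forced a≡c b≡c = ¬-not λ d≡c → free (trans a≡c (sym b≡c) , trans a≡c (sym d≡c))

  middle-forced : a ≡ c → d ≡ c → b ≡ not c
  middle-forced a≡c d≡c = ¬-not λ b≡c → free (trans a≡c (sym b≡c) , trans a≡c (sym d≡c))

  first-forced : b ≡ c → d ≡ c → a ≡ not c
  first-forced b≡c d≡c = ¬-not λ a≡c → free (trans a≡c (sym b≡c) , trans a≡c (sym d≡c))

pattern-components : ∀ {w x y z a b c d : Bool} →
  (w , x , y , z) ≡ (a , b , c , d) → w ≡ a × x ≡ b × y ≡ c × z ≡ d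
pattern-components refl = refl , refl , refl , refl

pattern-≡ : ∀ {w x y z a b c d : Bool} →
  w ≡ a → x ≡ b → y ≡ c → z ≡ d → (w , x , y , z) ≡ (a , b , c , d)
pattern-≡ refl refl refl refl = refl

module Triangles {R : ℕ} {G : Grid} (free : TriangleFree R G) where

  triangle : ∀ i k y {_ : True (1 ≤? y)} {_ : True (k + y ≤? 3)} {_ : True (i + y ≤? R)} →
             ¬ Monochromatic (G i k) (G i (k + y)) (G (i + y) (k + y))
  triangle i k y {p} {q} {r} = free i k y (toWitness p) (toWitness q) (toWitness r)

TriangleFree-mono : ∀ {R R′ G} → R ≤ R′ → TriangleFree R′ G → TriangleFree R G
TriangleFree-mono R≤R′ free i k y y≥1 k+y≤3 i+y≤R = free i k y y≥1 k+y≤3 (≤-trans i+y≤R R≤R′)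

next : Grid → Grid
next G i = G (suc i)

next-free : ∀ {R G} → TriangleFree (suc R) G → TriangleFree R (next G)
next-free free i k y y≥1 k+y≤3 i+y≤R = free (suc i) k y y≥1 k+y≤3 (s≤s i+y≤R)

no-three-in-a-row : ∀ {G} → TriangleFree 2 G → ∀ {c} → ¬ (G 0 0 ≡ c × G 0 1 ≡ c × G 0 2 ≡ c)
no-three-in-a-row {G} free {c} (g00 , g01 , g02) =
  triangle 1 1 1 (trans g11 (sym g12) , trans g11 (sym g22))
  where
  open Triangles free
  g11 : G 1 1 ≡ not c
  g11 = last-forced (triangle 0 0 1) g00 g01
  g12 : G 1 2 ≡ not c
  g12 = last-forced (triangle 0 1 1) g01 g02
  g22 : G 2 2 ≡ not c
  g22 = last-forced (triangle 0 0 2) g00 g02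

swap-colours : Grid → Grid
swap-colours G i k = not (G i k)

swap-colours-free : ∀ {R G} → TriangleFree R G → TriangleFree R (swap-colours G)
swap-colours-free free i k y y≥1 k+y≤3 i+y≤R (eq₁ , eq₂) =
  free i k y y≥1 k+y≤3 i+y≤R (not-injective eq₁ , not-injective eq₂)

swap-pattern : Pattern → Pattern
swap-pattern (a , b , c , d) = not a , not b , not c , not d

swap-pattern-involutive : ∀ p → swap-pattern (swap-pattern p) ≡ p
swap-pattern-involutive (a , b , c , d)
  rewrite not-involutive a | not-involutive b | not-involutive c | not-involutive d = refl

swap-pattern-injective : ∀ {p q} → swap-pattern p ≡ swap-pattern q → p ≡ q
swap-pattern-injective {p} {q} eq = begin
  p                             ≡⟨ swap-pattern-involutive p ⟨
  swap-pattern (swap-pattern p) ≡⟨ cong swap-pattern eq ⟩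
  swap-pattern (swap-pattern q) ≡⟨ swap-pattern-involutive q ⟩
  q                             ∎
  where open ≡-Reasoning

P0-P2⇒P0 : ∀ {G} → TriangleFree 4 G → ∀ u → Row G 0 ≡ P0 u → Row G 1 ≡ P2 u → Row G 2 ≡ P0 u
P0-P2⇒P0 {G} free false row₀ row₁ with pattern-components row₀ | pattern-components row₁
... | g00 , _ , _ , g03 | g10 , g11 , g12 , g13 = pattern-≡ g20 g21 g22 g23
  where
  open Triangles free
  g33 : G 3 3 ≡ true
  g33 = last-forced (triangle 0 0 3) g00 g03
  g43 : G 4 3 ≡ false
  g43 = last-forced (triangle 1 0 3) g10 g13
  g22 : G 2 2 ≡ true
  g22 = last-forced (triangle 1 1 1) g11 g12
  g23 : G 2 3 ≡ false
  g23 = middle-forced (triangle 2 2 1) g22 g33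
  g21 : G 2 1 ≡ true
  g21 = first-forced (triangle 2 1 2) g23 g43
  g20 : G 2 0 ≡ false
  g20 = ¬-not λ g20 → no-three-in-a-row (next-free (next-free free)) (g20 , g21 , g22)
P0-P2⇒P0 free true row₀ row₁ =
  swap-pattern-injective
    (P0-P2⇒P0 (swap-colours-free free) false (cong swap-pattern row₀) (cong swap-pattern row₁))

P0-P1⇒P2 : ∀ {G} → TriangleFree 4 G → ∀ u → Row G 0 ≡ P0 u → Row G 1 ≡ P1 u → Row G 2 ≡ P2 u
P0-P1⇒P2 {G} free false row₀ row₁ with pattern-components row₀ | pattern-components row₁
... | g00 , _ , _ , g03 | g10 , g11 , g12 , g13 = pattern-≡ g20 g21 g22 g23
  where
  open Triangles free
  g33 : G 3 3 ≡ true
  g33 = last-forced (triangle 0 0 3) g00 g03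
  g21 : G 2 1 ≡ false
  g21 = last-forced (triangle 1 0 1) g10 g11
  g23 : G 2 3 ≡ true
  g23 = last-forced (triangle 1 2 1) g12 g13
  g22 : G 2 2 ≡ false
  g22 = first-forced (triangle 2 2 1) g23 g33
  g20 : G 2 0 ≡ true
  g20 = ¬-not λ g20 → no-three-in-a-row (next-free (next-free free)) (g20 , g21 , g22)
P0-P1⇒P2 free true row₀ row₁ =
  swap-pattern-injective
    (P0-P1⇒P2 (swap-colours-free free) false (cong swap-pattern row₀) (cong swap-pattern row₁))

P0-P1-P2⇒P3 : ∀ {G} → TriangleFree 6 G → ∀ u →
  Row G 0 ≡ P0 u → Row G 1 ≡ P1 u → Row G 2 ≡ P2 u → Row G 3 ≡ P3 u
P0-P1-P2⇒P3 {G} free false row₀ row₁ row₂ with pattern-components row₀ | pattern-components row₂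
... | g00 , _ , _ , g03 | g20 , g21 , g22 , g23 = pattern-≡ g30 g31 g32 g33
  where
  open Triangles free
  g33 : G 3 3 ≡ true
  g33 = last-forced (triangle 0 0 3) g00 g03
  g53 : G 5 3 ≡ false
  g53 = last-forced (triangle 2 0 3) g20 g23
  g32 : G 3 2 ≡ true
  g32 = last-forced (triangle 2 1 1) g21 g22
  g43 : G 4 3 ≡ false
  g43 = last-forced (triangle 3 2 1) g32 g33
  g42 : G 4 2 ≡ true
  g42 = first-forced (triangle 4 2 1) g43 g53
  g31 : G 3 1 ≡ false
  g31 = first-forced (triangle 3 1 1) g32 g42
  g30 : G 3 0 ≡ false
  g30 = ¬-not λ g30 → triangle 5 2 1
    (trans (last-forced (triangle 3 0 2) g30 g32) (sym g53) ,
     trans (last-forced (triangle 3 0 2) g30 g32) (sym (last-forced (triangle 3 0 3) g30 g33)))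
P0-P1-P2⇒P3 free true row₀ row₁ row₂ =
  swap-pattern-injective (P0-P1-P2⇒P3 (swap-colours-free free) false
    (cong swap-pattern row₀) (cong swap-pattern row₁) (cong swap-pattern row₂))

P2≡P0∘not : ∀ u → P2 u ≡ P0 (not u)
P2≡P0∘not false = refl
P2≡P0∘not true  = refl

P3≡P1∘not : ∀ u → P3 u ≡ P1 (not u)
P3≡P1∘not false = refl
P3≡P1∘not true  = refl

P0≡P2∘not : ∀ u → P0 u ≡ P2 (not u)
P0≡P2∘not false = refl
P0≡P2∘not true  = refl

alternating : Bool → ℕ → Pattern
alternating u zero    = P0 u
alternating u (suc j) = alternating (not u) j

rows-alternating : ∀ n {G} u → TriangleFree (2 + n) G → Row G 0 ≡ P0 u → Row G 1 ≡ P2 u →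
  ∀ j → j ≤ n → Row G j ≡ alternating u j
rows-alternating n u free row₀ row₁ zero _ = row₀
rows-alternating n u free row₀ row₁ (suc zero) _ = trans row₁ (P2≡P0∘not u)
rows-alternating (suc (suc n)) u free row₀ row₁ (suc (suc j)) (s≤s j≤n) =
  rows-alternating (suc n) (not u) (next-free free) (trans row₁ (P2≡P0∘not u))
    (trans (P0-P2⇒P0 (TriangleFree-mono (m≤m+n 4 n) free) u row₀ row₁) (P0≡P2∘not u))
    (suc j) j≤n

cycling : Bool → ℕ → Pattern
cycling u zero          = P0 u
cycling u (suc zero)    = P1 u
cycling u (suc (suc j)) = cycling (not u) j

-- Written q * 2 rather than 2 * q so that suc q * 2 reduces to 2 + q * 2.
rows-cycling : ∀ q {G} u → TriangleFree (2 + q * 2) G → Row G 0 ≡ P0 u → Row G 1 ≡ P1 u →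
  ∀ j → j ≤ q * 2 → Row G j ≡ cycling u j
rows-cycling q u free row₀ row₁ zero _ = row₀
rows-cycling q u free row₀ row₁ (suc zero) _ = row₁
rows-cycling (suc q) u free row₀ row₁ (suc (suc zero)) _ =
  trans (P0-P1⇒P2 (TriangleFree-mono (m≤m+n 4 (q * 2)) free) u row₀ row₁) (P2≡P0∘not u)
rows-cycling (suc (suc q)) {G} u free row₀ row₁ (suc (suc (suc j))) (s≤s (s≤s 1+j≤)) =
  rows-cycling (suc q) (not u) (next-free (next-free free))
    (trans row₂ (P2≡P0∘not u)) (trans row₃ (P3≡P1∘not u)) (suc j) 1+j≤
  where
  row₂ : Row G 2 ≡ P2 u
  row₂ = P0-P1⇒P2 (TriangleFree-mono (m≤m+n 4 (suc q * 2)) free) u row₀ row₁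
  row₃ : Row G 3 ≡ P3 u
  row₃ = P0-P1-P2⇒P3 (TriangleFree-mono (m≤m+n 6 (q * 2)) free) u row₀ row₁ row₂

alternating-%2 : ∀ {p} u j → p ≡ alternating u j →
  (j % 2 ≡ 0 → p ≡ P0 u) × (j % 2 ≡ 1 → p ≡ P2 u)
alternating-%2 u zero eq = (λ _ → eq) , λ ()
alternating-%2 u (suc zero) eq = (λ ()) , λ _ → trans eq (sym (P2≡P0∘not u))
alternating-%2 u (suc (suc j)) eq rewrite not-involutive u = alternating-%2 u j eq

cycling-%4 : ∀ {p} u j → p ≡ cycling u j →
  (j % 4 ≡ 0 → p ≡ P0 u) × (j % 4 ≡ 1 → p ≡ P1 u) ×
  (j % 4 ≡ 2 → p ≡ P2 u) × (j % 4 ≡ 3 → p ≡ P3 u)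
cycling-%4 u zero eq = (λ _ → eq) , (λ ()) , (λ ()) , λ ()
cycling-%4 u (suc zero) eq = (λ ()) , (λ _ → eq) , (λ ()) , λ ()
cycling-%4 u (suc (suc zero)) eq =
  (λ ()) , (λ ()) , (λ _ → trans eq (sym (P2≡P0∘not u))) , λ ()
cycling-%4 u (suc (suc (suc zero))) eq =
  (λ ()) , (λ ()) , (λ ()) , λ _ → trans eq (sym (P3≡P1∘not u))
cycling-%4 u (suc (suc (suc (suc j)))) eq rewrite not-involutive u = cycling-%4 u j eq

column-step : ∀ b i k s t y → b + i * t + k * s + s * y ≡ b + i * t + (k + y) * s
column-step = solve-∀

diagonal-step : ∀ b i k s t y → b + i * t + k * s + (s + t) * y ≡ b + (i + y) * t + (k + y) * s
diagonal-step = solve-∀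

module _ {N s t : ℕ} {C : Coloring} (nm : NoMonoTriple N s t C) where

  window : ℕ → Grid
  window b i k = C (b + i * t + k * s)

  row-window : ∀ b i → Row (window b) i ≡ V s C (b + i * t)
  row-window b i rewrite +-identityʳ (b + i * t) | +-identityʳ s = refl

  window-free : ∀ {b R} → 1 ≤ b → b + R * t + 3 * s ≤ N → TriangleFree R (window b)
  window-free {b} {R} b≥1 fits i k y y≥1 k+y≤3 i+y≤R (eq₁ , eq₂) =
    nm x y x≥1 y≥1 (m+n≤o⇒n≤o k k+y≤3)
       (x≥1 , ≤-trans (m≤m+n x (s * y)) middle≤N)
       (≤-trans x≥1 (m≤m+n x (s * y)) , middle≤N)
       (≤-trans x≥1 (m≤m+n x ((s + t) * y)) , top≤N)
       (trans eq₁ (cong C (sym (column-step b i k s t y))) ,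
        trans eq₂ (cong C (sym (diagonal-step b i k s t y))))
    where
    x : ℕ
    x = b + i * t + k * s
    x≥1 : 1 ≤ x
    x≥1 = ≤-trans b≥1 (≤-trans (m≤m+n b (i * t)) (m≤m+n (b + i * t) (k * s)))
    top≤N : x + (s + t) * y ≤ N
    top≤N = ≤-trans (≤-reflexive (diagonal-step b i k s t y))
      (≤-trans (+-mono-≤ (+-monoʳ-≤ b (*-monoˡ-≤ t i+y≤R)) (*-monoˡ-≤ s k+y≤3)) fits)
    middle≤N : x + s * y ≤ N
    middle≤N = ≤-trans (+-monoʳ-≤ x (*-monoˡ-≤ y (m≤m+n s t))) top≤N

  row₀-window : ∀ a → Row (window a) 0 ≡ V s C a
  row₀-window a = trans (row-window a 0) (cong (V s C) (+-identityʳ a))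

  row₁-window : ∀ a → Row (window a) 1 ≡ V s C (a + t)
  row₁-window a = trans (row-window a 1) (cong (λ x → V s C (a + x)) (*-identityˡ t))

  V-alternating : ∀ {a} n u → 1 ≤ a → a + (2 + n) * t + 3 * s ≤ N →
    V s C a ≡ P0 u → V s C (a + t) ≡ P2 u → ∀ j → j ≤ n → V s C (a + j * t) ≡ alternating u j
  V-alternating {a} n u a≥1 fits V₀ V₁ j j≤n =
    trans (sym (row-window a j))
      (rows-alternating n u (window-free a≥1 fits)
        (trans (row₀-window a) V₀) (trans (row₁-window a) V₁) j j≤n)

  V-cycling : ∀ {a} q u → 1 ≤ a → a + (2 + q * 2) * t + 3 * s ≤ N →
    V s C a ≡ P0 u → V s C (a + t) ≡ P1 u → ∀ j → j ≤ q * 2 → V s C (a + j * t) ≡ cycling u j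
  V-cycling {a} q u a≥1 fits V₀ V₁ j j≤q*2 =
    trans (sym (row-window a j))
      (rows-cycling q u (window-free a≥1 fits)
        (trans (row₀-window a) V₀) (trans (row₁-window a) V₁) j j≤q*2)

window-length : ∀ a s t m → m * t + (a + 3 * s + 2 * t) ≡ a + (2 + m) * t + 3 * s
window-length = solve-∀

window-fits : ∀ {N} a s t m → a + 3 * s + 2 * t ≤ N → m * t ≤ N ∸ (a + 3 * s + 2 * t) →
  a + (2 + m) * t + 3 * s ≤ N
window-fits {N} a s t m M≤N m*t≤ =
  subst (_≤ N) (window-length a s t m) (m≤o∸n⇒m+n≤o (m * t) M≤N m*t≤)

mainTheorem2 : ∀ (N s t : ℕ) → 1 ≤ N → 1 ≤ s → (t>0 : 0 < t) →
    ∀ (C : Coloring) → NoMonoTriple N s t C →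
    ∀ (a : ℕ) → 1 ≤ a → a + 3 * s ≤ N → ∀ (u : Bool) →
    (V s C a ≡ P0 u → V s C (a + t) ≡ P1 u →
      a + 3 * s + 2 * t ≤ N →
      ∀ (j : ℕ) → j ≤ 2 * floorDiv (N ∸ (a + 3 * s + 2 * t)) (2 * t) (*-monoʳ-< 2 t>0) →
        (j % 4 ≡ 0 → V s C (a + j * t) ≡ P0 u) ×
        (j % 4 ≡ 1 → V s C (a + j * t) ≡ P1 u) ×
        (j % 4 ≡ 2 → V s C (a + j * t) ≡ P2 u) ×
        (j % 4 ≡ 3 → V s C (a + j * t) ≡ P3 u))
    ×
    (V s C a ≡ P0 u → V s C (a + t) ≡ P2 u →
      a + 3 * s + 2 * t ≤ N →
      ∀ (j : ℕ) → j ≤ floorDiv (N ∸ (a + 3 * s + 2 * t)) t t>0 →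
        (j % 2 ≡ 0 → V s C (a + j * t) ≡ P0 u) ×
        (j % 2 ≡ 1 → V s C (a + j * t) ≡ P2 u))
mainTheorem2 N s t _ _ t>0 C nm a a≥1 _ u =
  (λ V₀ V₁ M≤N j j≤2q → cycling-%4 u j
     (V-cycling nm q u a≥1 (window-fits a s t (q * 2) M≤N q*2*t≤) V₀ V₁
        j (subst (j ≤_) (*-comm 2 q) j≤2q))) ,
  (λ V₀ V₁ M≤N j j≤n → alternating-%2 u j
     (V-alternating nm n u a≥1 (window-fits a s t n M≤N n*t≤) V₀ V₁ j j≤n))
  where
  room : ℕ
  room = N ∸ (a + 3 * s + 2 * t)
  q : ℕ
  q = floorDiv room (2 * t) (*-monoʳ-< 2 t>0)
  n : ℕ
  n = floorDiv room t t>0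
  q*2*t≤ : q * 2 * t ≤ room
  q*2*t≤ = subst (_≤ room) (sym (*-assoc q 2 t))
    (m/n*n≤m room (2 * t) {{>-nonZero (*-monoʳ-< 2 t>0)}})
  n*t≤ : n * t ≤ room
  n*t≤ = m/n*n≤m room t {{>-nonZero t>0}}
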